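{- Let $H$ be a digraph (possibly with loops), $D$ an $H$-colored digraph and $\mathscr{F}$ an $H$-class partition of $A(D)$. If $D$ is strongly connected, then $C_{\mathscr{F}}(D)$ is strongly connected.
   Context: An $H$-colored digraph is a finite digraph $D$ without loops with a coloring $\rho:A(D)\to V(H)$. An $H$-class partition of $A(D)$ is a partition $\mathscr{F}$ of $A(D)$ such that for all arcs $(u,v),(v,w)$ of $D$, $(\rho(u,v),\rho(v,w))\in A(H)$ iff some $F\in\mathscr{F}$ contains both arcs. The $H$-class digraph $C_{\mathscr{F}}(D)$ has vertex set $\mathscr{F}$, and $(F,G)$ (possibly a loop) is an arc iff there exist $(u,v)\in F$ and $(v,w)\in G$. -}

module Defs where

open import Data.Nat using (ℕ)
open import Data.Fin using (Fin)
open import Data.Bool using (Bool; T)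
open import Data.Product using (Σ; ∃; _×_; _,_)
open import Relation.Binary.PropositionalEquality using (_≡_)
open import Relation.Nullary using (¬_)
open import Relation.Binary.Construct.Closure.ReflexiveTransitive using (Star)

-- A finite digraph on vertex set Fin n, given by a Boolean adjacency matrix
-- (so there is at most one arc from u to v).
record Digraph : Set where
  field
    size : ℕ
    adj  : Fin size → Fin size → Bool

open Digraph public

Vertex : Digraph → Set
Vertex D = Fin (size D)

Loopless : Digraph → Set
Loopless D = ∀ (v : Vertex D) → ¬ T (adj D v v)

record Arc (D : Digraph) : Set where
  constructor arc
  field
    tail : Vertex D
    head : Vertex D
    isArc : T (adj D tail head)

open Arc public

-- A digraph H possibly with loops: vertex set Fin h, arbitrary arc relation
-- (loops allowed).
-- An H-colored digraph: a loopless digraph D with a colouring ρ : A(D) → V(H).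
Coloring : Digraph → ℕ → Set
Coloring D h = Arc D → Fin h

StronglyConnected : {V : Set} → (V → V → Set) → Set
StronglyConnected {V} E = ∀ (x y : V) → Star E x y

DArc : (D : Digraph) → Vertex D → Vertex D → Set
DArc D u v = T (adj D u v)

record Partition (D : Digraph) (k : ℕ) : Set where
  field
    cls      : Arc D → Fin k
    nonempty : ∀ (i : Fin k) → ∃ λ (a : Arc D) → cls a ≡ i

open Partition public

IsHClassPartition : (D : Digraph) (h : ℕ) (HA : Fin h → Fin h → Set)
                    (ρ : Coloring D h) {k : ℕ} → Partition D k → Set
IsHClassPartition D h HA ρ P =
  ∀ (a b : Arc D) → head a ≡ tail b →
    (HA (ρ a) (ρ b) → cls P a ≡ cls P b) × (cls P a ≡ cls P b → HA (ρ a) (ρ b))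

-- Arc relation of the H-class digraph C_F(D) on vertex set Fin k (the classes):
-- (F , G) is an arc (possibly a loop) iff some (u,v) ∈ F and (v,w) ∈ G.
ClassArc : (D : Digraph) {k : ℕ} → Partition D k → Fin k → Fin k → Set
ClassArc D P F G =
  Σ (Arc D) λ a → Σ (Arc D) λ b → head a ≡ tail b × cls P a ≡ F × cls P b ≡ G

-- Pick arcs a ∈ F and b ∈ G. Strong connectivity of D gives a walk from the
-- head of a to the tail of b; prefixed by a and suffixed by b it is a sequence
-- of consecutive arcs, and consecutive arcs lie in classes joined by an arc of
-- C_F(D).
module Submission where

open import Defs
open import Data.Nat using (ℕ)
open import Data.Fin using (Fin)
open import Data.Product using (_,_)
open import Relation.Binary.PropositionalEquality using (_≡_; refl)
open import Relation.Binary.Construct.Closure.ReflexiveTransitive using (Star; ε; _◅_)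

consecutive⇒classArc : (D : Digraph) {k : ℕ} (P : Partition D k) (a b : Arc D) →
                       head a ≡ tail b → ClassArc D P (cls P a) (cls P b)
consecutive⇒classArc D P a b a↦b = a , b , a↦b , refl , refl

-- The walk starts at an arbitrary v with head a ≡ v so that ε can be matched.
walk⇒classWalk : (D : Digraph) {k : ℕ} (P : Partition D k) (a b : Arc D) {v : Vertex D} →
                 head a ≡ v → Star (DArc D) v (tail b) →
                 Star (ClassArc D P) (cls P a) (cls P b)
walk⇒classWalk D P a b a↦v ε = consecutive⇒classArc D P a b a↦v ◅ ε
walk⇒classWalk D P a b {v} a↦v (_◅_ {j = w} v→w w⇝b) =
  consecutive⇒classArc D P a c a↦v ◅ walk⇒classWalk D P c b refl w⇝b
  where c = arc v w v→w

lemma7 : (h : ℕ) (HA : Fin h → Fin h → Set)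
         (D : Digraph) → Loopless D → (ρ : Coloring D h)
         {k : ℕ} (P : Partition D k) → IsHClassPartition D h HA ρ P →
         StronglyConnected (DArc D) →
         StronglyConnected (ClassArc D P)
lemma7 h HA D _ ρ P _ strong F G with nonempty P F | nonempty P G
... | a , refl | b , refl = walk⇒classWalk D P a b refl (strong (head a) (tail b))
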